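{- Let $p$ be a binary word of length $l$ with exactly $3$ runs whose second run has size at least $2$. Then for every $n \ge l$, every binary word $w$ of length $n$ with $c_p(w) = M_{n,p}$ has exactly $3$ runs.
   Context: A binary word is a finite sequence over $\{0,1\}$. An occurrence of $p = p_1\cdots p_l$ in $w = w_1\cdots w_n$ is a choice of indices $1 \le i_1 < \cdots < i_l \le n$ with $w_{i_1}\cdots w_{i_l} = p$; $c_p(w)$ is the number of occurrences, and $M_{n,p} = \max\{c_p(w) : w \in \{0,1\}^n\}$. A run is a maximal block of consecutive equal letters; its size is its length. -}

module Defs where

open import Data.Bool using (Bool; true; false; _∧_; if_then_else_)
open import Data.Bool.Properties using () renaming (_≟_ to _≟ᵇ_)
open import Data.Nat using (ℕ; zero; suc; _+_; _⊔_)
open import Data.List using (List; []; _∷_; map; _++_; foldr; length)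
open import Relation.Nullary using (yes; no)

-- Binary words are lists of Booleans (false = 0, true = 1).
Word : Set
Word = List Bool

-- c p w : number of occurrences of p as a (scattered) subsequence of w,
-- i.e. number of index tuples i₁ < … < iₗ with w_{i₁}…w_{iₗ} = p.
-- Standard recursion: occurrences either avoid the first letter of w,
-- or use it to match the first letter of p.
c : Word → Word → ℕ
c []       _        = 1
c (_ ∷ _)  []       = 0
c (a ∷ p)  (b ∷ w) with a ≟ᵇ b
... | yes _ = c (a ∷ p) w + c p w
... | no  _ = c (a ∷ p) w

allWords : ℕ → List Word
allWords zero    = [] ∷ []
allWords (suc n) = map (false ∷_) (allWords n) ++ map (true ∷_) (allWords n)

M : ℕ → Word → ℕ
M n p = foldr (λ w m → c p w ⊔ m) 0 (allWords n)

-- Run decomposition: list of run sizes (maximal blocks of equal letters), in order.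
runsFrom : Bool → ℕ → Word → List ℕ
runsFrom a k []      = suc k ∷ []
runsFrom a k (b ∷ w) with a ≟ᵇ b
... | yes _ = runsFrom a (suc k) w
... | no  _ = suc k ∷ runsFrom b 0 w

runs : Word → List ℕ
runs []      = []
runs (a ∷ w) = runsFrom a 0 w

numRuns : Word → ℕ
numRuns w = length (runs w)

module Submission where

-- Write p = aʳ b^q aᵗ with b = not a, where r, t ≥ 1 and q ≥ 2. Splitting the occurrences of p in
-- aˣ b u according to whether they use that b gives, by induction on w, c p w ≤ m · C(#b w, q)
-- for every m bounding C(β, r) · C(γ, t) over the splits β + γ = #a w. For a maximizing split
-- (α, γ) the three-run word aᵅ b^(#b w) aᵞ, which has the length of w, reaches this bound. If
-- c p w > 0 and w does not have three runs, the bound is strict at the first b of w: either the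
-- split of the a's there is not maximal, or the rest u of w is not of the form b*a*, and then the
-- suffix b^(q-1) aᵗ has fewer than C(#b u, q - 1) · C(#a u, t) occurrences in u.

open import Defs
import Algebra.Properties.CommutativeSemigroup as CommutativeSemigroupProperties
open import Data.Bool using (Bool; true; false; not)
open import Data.Bool.Properties using (not-involutive; not-¬; ¬-not) renaming (_≟_ to _≟ᵇ_)
open import Data.Empty using (⊥-elim)
open import Data.List using ([]; _∷_; _++_; length; foldr; map; replicate)
open import Data.List.Membership.Propositional using (_∈_)
open import Data.List.Membership.Propositional.Properties using (∈-map⁺; ∈-++⁺ˡ; ∈-++⁺ʳ)
open import Data.List.Properties using (length-++; length-replicate; ++-identityʳ)
open import Data.List.Relation.Unary.Any using (here; there)
open import Data.Nat
  using (ℕ; zero; suc; _+_; _*_; _∸_; _⊔_; _≤_; _≥_; _<_; z≤n; s≤s; _≤?_; _<?_; >-nonZero; >-nonZero⁻¹)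
open import Data.Nat.Properties
open import Data.Product using (_×_; _,_; ∃-syntax)
open import Data.Sum using (_⊎_; inj₁; inj₂)
open import Function using (_∘_)
open import Relation.Binary.PropositionalEquality
  using (_≡_; _≢_; refl; sym; trans; cong; cong₂; subst; ≢-sym; module ≡-Reasoning)
open import Relation.Nullary using (yes; no)
open import Relation.Nullary.Decidable using (decidable-stable)

module +-CS = CommutativeSemigroupProperties +-commutativeSemigroup
module *-CS = CommutativeSemigroupProperties *-commutativeSemigroup

-- Pascal's rule as the definition, so that the recurrences used below hold by computation
-- (Data.Nat.Combinatorics._C_ is defined through factorials).
choose : ℕ → ℕ → ℕ
choose n       zero    = 1
choose zero    (suc k) = 0
choose (suc n) (suc k) = choose n (suc k) + choose n k

n<k⇒choose≡0 : ∀ {n k} → n < k → choose n k ≡ 0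
n<k⇒choose≡0 {zero}  {suc k} _         = refl
n<k⇒choose≡0 {suc n} {suc k} (s≤s n<k) = cong₂ _+_ (n<k⇒choose≡0 (m<n⇒m<1+n n<k)) (n<k⇒choose≡0 n<k)

k≤n⇒0<choose : ∀ {n k} → k ≤ n → 0 < choose n k
k≤n⇒0<choose {n}     {zero}  _         = s≤s z≤n
k≤n⇒0<choose {suc n} {suc k} (s≤s k≤n) = ≤-trans (k≤n⇒0<choose k≤n) (m≤n+m _ _)

0<choose⇒k≤n : ∀ {n k} → 0 < choose n k → k ≤ n
0<choose⇒k≤n {n} {k} 0<C with k ≤? n
... | yes k≤n = k≤n
... | no  k≰n = ⊥-elim (>⇒≢ 0<C (n<k⇒choose≡0 (≰⇒> k≰n)))

choose-monoˡ-≤ : ∀ n k → choose n k ≤ choose (suc n) k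
choose-monoˡ-≤ n zero    = ≤-refl
choose-monoˡ-≤ n (suc k) = m≤m+n _ _

choose-monoˡ-< : ∀ {n k} → k ≤ n → choose n (suc k) < choose (suc n) (suc k)
choose-monoˡ-< k≤n = m<m+n _ (k≤n⇒0<choose k≤n)

0<*⇒0<ˡ : ∀ m {n} → 0 < m * n → 0 < m
0<*⇒0<ˡ m 0<mn = >-nonZero⁻¹ m {{m*n≢0⇒m≢0 m {{>-nonZero 0<mn}}}}

0<*⇒0<ʳ : ∀ m {n} → 0 < m * n → 0 < n
0<*⇒0<ʳ m {n} 0<mn = 0<*⇒0<ˡ n (subst (0 <_) (*-comm m n) 0<mn)

split-argmax : ∀ (f : ℕ → ℕ → ℕ) N →
               ∃[ β ] ∃[ γ ] β + γ ≡ N × (∀ β′ γ′ → β′ + γ′ ≡ N → f β′ γ′ ≤ f β γ)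
split-argmax f zero = 0 , 0 , refl , λ { zero zero _ → ≤-refl ; zero (suc _) () ; (suc _) _ () }
split-argmax f (suc N) with split-argmax (f ∘ suc) N
... | β , γ , β+γ≡N , max with f 0 (suc N) ≤? f (suc β) γ
...   | yes ≤f = suc β , γ , cong suc β+γ≡N , λ
          { zero ._ refl → ≤f
          ; (suc β′) γ′ eq → max β′ γ′ (suc-injective eq) }
...   | no  ≰f = 0 , suc N , refl , λ
          { zero ._ refl → ≤-refl
          ; (suc β′) γ′ eq → ≤-trans (max β′ γ′ (suc-injective eq)) (<⇒≤ (≰⇒> ≰f)) }

infix 8 _^_

_^_ : Bool → ℕ → Word
x ^ n = replicate n x

^-++-∷ : ∀ x n w → x ^ n ++ x ∷ w ≡ x ^ suc n ++ w
^-++-∷ x zero    w = refl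
^-++-∷ x (suc n) w = cong (x ∷_) (^-++-∷ x n w)

blocks : Bool → ℕ → ℕ → ℕ → Word
blocks a i j k = a ^ i ++ not a ^ j ++ a ^ k

count : Bool → Word → ℕ
count x []      = 0
count x (y ∷ w) with x ≟ᵇ y
... | yes _ = suc (count x w)
... | no  _ = count x w

count-head-≡ : ∀ x w → count x (x ∷ w) ≡ suc (count x w)
count-head-≡ x w with x ≟ᵇ x
... | yes _   = refl
... | no  x≢x = ⊥-elim (x≢x refl)

count-head-≢ : ∀ {x y} w → x ≢ y → count x (y ∷ w) ≡ count x w
count-head-≢ {x} {y} w x≢y with x ≟ᵇ y
... | yes x≡y = ⊥-elim (x≢y x≡y)
... | no  _   = refl

count-^ : ∀ x n → count x (x ^ n) ≡ n
count-^ x zero    = refl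
count-^ x (suc n) = trans (count-head-≡ x (x ^ n)) (cong suc (count-^ x n))

count-^-++ : ∀ x n v → count x (x ^ n ++ v) ≡ n + count x v
count-^-++ x zero    v = refl
count-^-++ x (suc n) v = trans (count-head-≡ x (x ^ n ++ v)) (cong suc (count-^-++ x n v))

count-^-++-≢ : ∀ {x y} n v → x ≢ y → count x (y ^ n ++ v) ≡ count x v
count-^-++-≢         zero    v x≢y = refl
count-^-++-≢ {y = y} (suc n) v x≢y = trans (count-head-≢ (y ^ n ++ v) x≢y) (count-^-++-≢ n v x≢y)

c-head-≡ : ∀ x p w → c (x ∷ p) (x ∷ w) ≡ c (x ∷ p) w + c p w
c-head-≡ x p w with x ≟ᵇ x
... | yes _   = refl
... | no  x≢x = ⊥-elim (x≢x refl)

c-head-≢ : ∀ {x y} p w → x ≢ y → c (x ∷ p) (y ∷ w) ≡ c (x ∷ p) w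
c-head-≢ {x} {y} p w x≢y with x ≟ᵇ y
... | yes x≡y = ⊥-elim (x≢y x≡y)
... | no  _   = refl

c-^ : ∀ x t v → c (x ^ t) v ≡ choose (count x v) t
c-^ x zero    v       = refl
c-^ x (suc t) []      = refl
c-^ x (suc t) (y ∷ v) with x ≟ᵇ y
... | yes _ = cong₂ _+_ (c-^ x (suc t) v) (c-^ x t v)
... | no  _ = c-^ x (suc t) v

c-^-^ : ∀ x m n → c (x ^ n) (x ^ m) ≡ choose m n
c-^-^ x m n = trans (c-^ x n (x ^ m)) (cong (λ k → choose k n) (count-^ x m))

c-∷-≥ : ∀ q y v → c q v ≤ c q (y ∷ v)
c-∷-≥ []      y v = ≤-refl
c-∷-≥ (x ∷ q) y v with x ≟ᵇ y
... | yes _ = m≤m+n _ _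
... | no  _ = ≤-refl

c-++-≥ʳ : ∀ q u v → c q v ≤ c q (u ++ v)
c-++-≥ʳ q []      v = ≤-refl
c-++-≥ʳ q (y ∷ u) v = ≤-trans (c-++-≥ʳ q u v) (c-∷-≥ q y (u ++ v))

c-++-≥ : ∀ p q u v → c p u * c q v ≤ c (p ++ q) (u ++ v)
c-++-≥ []      q u       v = ≤-trans (≤-reflexive (*-identityˡ (c q v))) (c-++-≥ʳ q u v)
c-++-≥ (x ∷ p) q []      v = z≤n
c-++-≥ (x ∷ p) q (y ∷ u) v with x ≟ᵇ y
... | yes _ = ≤-trans (≤-reflexive (*-distribʳ-+ (c q v) (c (x ∷ p) u) (c p u)))
                      (+-mono-≤ (c-++-≥ (x ∷ p) q u v) (c-++-≥ p q u v))
... | no  _ = c-++-≥ (x ∷ p) q u v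

c-self : ∀ p v → 0 < c p (p ++ v)
c-self []      v = s≤s z≤n
c-self (x ∷ p) v = subst (0 <_) (sym (c-head-≡ x p (p ++ v))) (≤-trans (c-self p v) (m≤n+m _ _))

c-blocks-≥ : ∀ a r q t α β γ → choose α r * choose β q * choose γ t ≤ c (blocks a r q t) (blocks a α β γ)
c-blocks-≥ a r q t α β γ = begin
  choose α r * choose β q * choose γ t
    ≡⟨ *-assoc (choose α r) _ _ ⟩
  choose α r * (choose β q * choose γ t)
    ≡⟨ sym (cong₂ _*_ (c-^-^ a α r) (cong₂ _*_ (c-^-^ (not a) β q) (c-^-^ a γ t))) ⟩
  c (a ^ r) (a ^ α) * (c (not a ^ q) (not a ^ β) * c (a ^ t) (a ^ γ))
    ≤⟨ *-monoʳ-≤ (c (a ^ r) (a ^ α)) (c-++-≥ (not a ^ q) (a ^ t) (not a ^ β) (a ^ γ)) ⟩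
  c (a ^ r) (a ^ α) * c (not a ^ q ++ a ^ t) (not a ^ β ++ a ^ γ)
    ≤⟨ c-++-≥ (a ^ r) (not a ^ q ++ a ^ t) (a ^ α) (not a ^ β ++ a ^ γ) ⟩
  c (blocks a r q t) (blocks a α β γ) ∎
  where open ≤-Reasoning

∈-allWords : ∀ w → w ∈ allWords (length w)
∈-allWords []          = here refl
∈-allWords (false ∷ w) = ∈-++⁺ˡ (∈-map⁺ (false ∷_) (∈-allWords w))
∈-allWords (true  ∷ w) = ∈-++⁺ʳ (map (false ∷_) (allWords (length w))) (∈-map⁺ (true ∷_) (∈-allWords w))

c≤M : ∀ p {n} w → length w ≡ n → c p w ≤ M n p
c≤M p w refl = c≤foldr (∈-allWords w)
  where
  c≤foldr : ∀ {ws} → w ∈ ws → c p w ≤ foldr (λ v m → c p v ⊔ m) 0 ws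
  c≤foldr          (here refl)  = m≤m⊔n _ _
  c≤foldr {v ∷ _} (there w∈ws) = ≤-trans (c≤foldr w∈ws) (m≤n⊔m (c p v) _)

runsFrom-≡ : ∀ y k v → runsFrom y k (y ∷ v) ≡ runsFrom y (suc k) v
runsFrom-≡ y k v with y ≟ᵇ y
... | yes _   = refl
... | no  y≢y = ⊥-elim (y≢y refl)

runsFrom-≢ : ∀ {y y′} k v → y ≢ y′ → runsFrom y k (y′ ∷ v) ≡ suc k ∷ runsFrom y′ 0 v
runsFrom-≢ {y} {y′} k v y≢y′ with y ≟ᵇ y′
... | yes y≡y′ = ⊥-elim (y≢y′ y≡y′)
... | no  _    = refl

runsFrom-^-++ : ∀ y m k v → runsFrom y k (y ^ m ++ v) ≡ runsFrom y (m + k) v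
runsFrom-^-++ y zero    k v = refl
runsFrom-^-++ y (suc m) k v = begin
  runsFrom y k (y ∷ y ^ m ++ v)    ≡⟨ runsFrom-≡ y k (y ^ m ++ v) ⟩
  runsFrom y (suc k) (y ^ m ++ v)  ≡⟨ runsFrom-^-++ y m (suc k) v ⟩
  runsFrom y (m + suc k) v         ≡⟨ cong (λ n → runsFrom y n v) (+-suc m k) ⟩
  runsFrom y (suc m + k) v         ∎
  where open ≡-Reasoning

runsFrom-^ : ∀ y m k → runsFrom y k (y ^ m) ≡ suc (m + k) ∷ []
runsFrom-^ y m k = trans (cong (runsFrom y k) (sym (++-identityʳ (y ^ m)))) (runsFrom-^-++ y m k [])

runsFrom≢[] : ∀ y k w → runsFrom y k w ≢ []
runsFrom≢[] y k []       ()
runsFrom≢[] y k (y′ ∷ w) with y ≟ᵇ y′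
... | yes _ = runsFrom≢[] y (suc k) w
... | no  _ = λ ()

runsFrom-inversion : ∀ y k w {m ms} → runsFrom y k w ≡ m ∷ ms →
  ∃[ j ] m ≡ suc (k + j) ×
    (w ≡ y ^ j × ms ≡ [] ⊎ ∃[ w′ ] w ≡ y ^ j ++ not y ∷ w′ × ms ≡ runsFrom (not y) 0 w′)
runsFrom-inversion y k [] refl = 0 , cong suc (sym (+-identityʳ k)) , inj₁ (refl , refl)
runsFrom-inversion y k (y′ ∷ w) eq with y ≟ᵇ y′
... | yes refl with runsFrom-inversion y (suc k) w eq
...   | j , m≡ , inj₁ (w≡ , ms≡)      = suc j , trans m≡ (cong suc (sym (+-suc k j))) , inj₁ (cong (y ∷_) w≡ , ms≡)
...   | j , m≡ , inj₂ (w′ , w≡ , ms≡) = suc j , trans m≡ (cong suc (sym (+-suc k j))) , inj₂ (w′ , cong (y ∷_) w≡ , ms≡)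
runsFrom-inversion y k (y′ ∷ w) eq | no y≢y′ with ¬-not (≢-sym y≢y′) | eq
... | refl | refl = 0 , cong suc (sym (+-identityʳ k)) , inj₂ (w , refl , refl)

numRuns-blocks : ∀ a {i j k} → 0 < i → 0 < j → 0 < k → numRuns (blocks a i j k) ≡ 3
numRuns-blocks a {suc i} {suc j} {suc k} _ _ _
  rewrite runsFrom-^-++ a i 0 (not a ∷ not a ^ j ++ a ^ suc k)
        | runsFrom-≢ (i + 0) (not a ^ j ++ a ^ suc k) (not-¬ {a} refl)
        | runsFrom-^-++ (not a) j 0 (a ^ suc k)
        | runsFrom-≢ (j + 0) (a ^ k) (≢-sym (not-¬ {a} refl))
        | runsFrom-^ a k 0
        = refl

three-runs-shape : ∀ p {r₁ r₂ r₃} → runs p ≡ r₁ ∷ r₂ ∷ r₃ ∷ [] → 2 ≤ r₂ →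
                   ∃[ a ] ∃[ r ] ∃[ q ] ∃[ t ] p ≡ blocks a (suc r) (suc (suc q)) (suc t)
three-runs-shape [] ()
three-runs-shape (a ∷ p) runs≡ 2≤r₂ with runsFrom-inversion a 0 p runs≡
... | _ , _ , inj₁ (_ , ())
... | i , _ , inj₂ (p₁ , refl , runs₁≡) with runsFrom-inversion (not a) 0 p₁ (sym runs₁≡)
...   | _ , _ , inj₁ (_ , ())
...   | j , refl , inj₂ (p₂ , refl , runs₂≡) with runsFrom-inversion (not (not a)) 0 p₂ (sym runs₂≡)
...     | _ , _ , inj₂ (p₃ , _ , runs₃≡) = ⊥-elim (runsFrom≢[] _ 0 p₃ (sym runs₃≡))
...     | k , _ , inj₁ (refl , _) = shape j 2≤r₂
  where
  shape : ∀ j → 2 ≤ suc j → ∃[ a′ ] ∃[ r ] ∃[ q ] ∃[ t ]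
          a ∷ a ^ i ++ not a ∷ not a ^ j ++ not (not a) ∷ not (not a) ^ k ≡ blocks a′ (suc r) (suc (suc q)) (suc t)
  shape zero    (s≤s ())
  shape (suc q) _ rewrite not-involutive a = a , i , q , k , refl

module Letters (a : Bool) where

  b : Bool
  b = not a

  a≢b : a ≢ b
  a≢b = not-¬ refl

  b≢a : b ≢ a
  b≢a = ≢-sym a≢b

  letter : ∀ y → y ≡ a ⊎ y ≡ b
  letter y with a ≟ᵇ y
  ... | yes a≡y = inj₁ (sym a≡y)
  ... | no  a≢y = inj₂ (¬-not (≢-sym a≢y))

  A B : Word → ℕ
  A = count a
  B = count b

  A+B≡length : ∀ w → A w + B w ≡ length w
  A+B≡length []      = refl
  A+B≡length (y ∷ w) with letter y
  ... | inj₁ refl = trans (cong₂ _+_ (count-head-≡ a w) (count-head-≢ w b≢a)) (cong suc (A+B≡length w))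
  ... | inj₂ refl = trans (cong₂ _+_ (count-head-≢ w a≢b) (count-head-≡ b w))
                          (trans (+-suc (A w) (B w)) (cong suc (A+B≡length w)))

  A-sorted : ∀ j z → A (b ^ j ++ a ^ z) ≡ z
  A-sorted j z = trans (count-^-++-≢ j (a ^ z) a≢b) (count-^ a z)

  A-a^-b∷ : ∀ x u → A (a ^ x ++ b ∷ u) ≡ x + A u
  A-a^-b∷ x u = trans (count-^-++ a x (b ∷ u)) (cong (x +_) (count-head-≢ u a≢b))

  B-a^-b∷ : ∀ x u → B (a ^ x ++ b ∷ u) ≡ suc (B u)
  B-a^-b∷ x u = trans (count-^-++-≢ x (b ∷ u) b≢a) (count-head-≡ b u)

  length-blocks : ∀ {w} α γ → α + γ ≡ A w → length (blocks a α (B w) γ) ≡ length w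
  length-blocks {w} α γ α+γ≡A = begin
    length (a ^ α ++ b ^ B w ++ a ^ γ)
      ≡⟨ length-++ (a ^ α) ⟩
    length (a ^ α) + length (b ^ B w ++ a ^ γ)
      ≡⟨ cong₂ _+_ (length-replicate α) (trans (length-++ (b ^ B w)) (cong₂ _+_ (length-replicate (B w)) (length-replicate γ))) ⟩
    α + (B w + γ)  ≡⟨ +-CS.x∙yz≈xz∙y α (B w) γ ⟩
    α + γ + B w    ≡⟨ cong (_+ B w) α+γ≡A ⟩
    A w + B w      ≡⟨ A+B≡length w ⟩
    length w       ∎
    where open ≡-Reasoning

  data LeadingAs : Word → Set where
    only-a : ∀ x → LeadingAs (a ^ x)
    a^-b∷  : ∀ x u → LeadingAs (a ^ x ++ b ∷ u)

  leadingAs : ∀ w → LeadingAs w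
  leadingAs []      = only-a 0
  leadingAs (y ∷ w) with letter y
  ... | inj₂ refl = a^-b∷ 0 w
  ... | inj₁ refl with leadingAs w
  ...   | only-a x  = only-a (suc x)
  ...   | a^-b∷ x u = a^-b∷ (suc x) u

  data Unsorted : Word → Set where
    a-then-b : ∀ {v} → 0 < B v → Unsorted (a ∷ v)
    skip-b   : ∀ {v} → Unsorted v → Unsorted (b ∷ v)

  0<B-unsorted : ∀ {v} → Unsorted v → 0 < B v
  0<B-unsorted (a-then-b {v} 0<B) = subst (0 <_) (sym (count-head-≢ v b≢a)) 0<B
  0<B-unsorted (skip-b {v} _)     = subst (0 <_) (sym (count-head-≡ b v)) (s≤s z≤n)

  data SortedView : Word → Set where
    sorted   : ∀ j z → SortedView (b ^ j ++ a ^ z)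
    unsorted : ∀ {u} → Unsorted u → SortedView u

  sortedView : ∀ u → SortedView u
  sortedView []      = sorted 0 0
  sortedView (y ∷ u) with letter y
  ... | inj₁ refl with leadingAs u
  ...   | only-a z  = sorted 0 (suc z)
  ...   | a^-b∷ x v = unsorted (a-then-b (subst (0 <_) (sym (B-a^-b∷ x v)) (s≤s z≤n)))
  sortedView (y ∷ u) | inj₂ refl with sortedView u
  ...   | sorted j z   = sorted (suc j) z
  ...   | unsorted uns = unsorted (skip-b uns)

  c-sorted-≤ : ∀ k t v → c (b ^ k ++ a ^ t) v ≤ choose (B v) k * choose (A v) t
  c-sorted-≤ zero    t v       = ≤-reflexive (trans (c-^ a t v) (sym (*-identityˡ _)))
  c-sorted-≤ (suc k) t []      = z≤n
  c-sorted-≤ (suc k) t (y ∷ v) with letter y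
  ... | inj₁ refl rewrite c-head-≢ (b ^ k ++ a ^ t) v b≢a | count-head-≡ a v | count-head-≢ v b≢a =
    ≤-trans (c-sorted-≤ (suc k) t v) (*-monoʳ-≤ (choose (B v) (suc k)) (choose-monoˡ-≤ (A v) t))
  ... | inj₂ refl rewrite c-head-≡ b (b ^ k ++ a ^ t) v | count-head-≡ b v | count-head-≢ v a≢b =
    ≤-trans (+-mono-≤ (c-sorted-≤ (suc k) t v) (c-sorted-≤ k t v))
            (≤-reflexive (sym (*-distribʳ-+ (choose (A v) t) (choose (B v) (suc k)) (choose (B v) k))))

  c-sorted-< : ∀ k t v → Unsorted v → suc k ≤ B v → suc t ≤ A v →
               c (b ^ suc k ++ a ^ suc t) v < choose (B v) (suc k) * choose (A v) (suc t)
  c-sorted-< k t _ (a-then-b {v} _) k<B t<A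
    rewrite c-head-≢ (b ^ k ++ a ^ suc t) v b≢a | count-head-≡ a v | count-head-≢ v b≢a =
    ≤-<-trans (c-sorted-≤ (suc k) (suc t) v)
              (*-monoʳ-< _ {{>-nonZero (k≤n⇒0<choose k<B)}} (choose-monoˡ-< (≤-pred t<A)))
  c-sorted-< k t _ (skip-b {v} uns) k<B t<A
    rewrite c-head-≡ b (b ^ k ++ a ^ suc t) v | count-head-≡ b v | count-head-≢ v a≢b =
    <-≤-trans (split k k<B)
              (≤-reflexive (sym (*-distribʳ-+ (choose (A v) (suc t)) (choose (B v) (suc k)) (choose (B v) k))))
    where
    split : ∀ k → suc k ≤ suc (B v) →
            c (b ^ suc k ++ a ^ suc t) v + c (b ^ k ++ a ^ suc t) v
              < choose (B v) (suc k) * choose (A v) (suc t) + choose (B v) k * choose (A v) (suc t)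
    split zero    _   = +-mono-<-≤ (c-sorted-< 0 t v uns (0<B-unsorted uns) t<A) (c-sorted-≤ 0 (suc t) v)
    split (suc k) k<B = +-mono-≤-< (c-sorted-≤ (suc (suc k)) (suc t) v) (c-sorted-< k t v uns (≤-pred k<B) t<A)

  c-no-b : ∀ P x j → c (a ^ j ++ b ∷ P) (a ^ x) ≡ 0
  c-no-b P zero    zero    = refl
  c-no-b P zero    (suc j) = refl
  c-no-b P (suc x) zero    = trans (c-head-≢ P (a ^ x) b≢a) (c-no-b P x zero)
  c-no-b P (suc x) (suc j) = trans (c-head-≡ a (a ^ j ++ b ∷ P) (a ^ x)) (cong₂ _+_ (c-no-b P x (suc j)) (c-no-b P x j))

  c-expand : ∀ P x j w → c (a ^ j ++ b ∷ P) (a ^ x ++ b ∷ w) ≡ c (a ^ j ++ b ∷ P) (a ^ x ++ w) + choose x j * c P w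
  c-expand P zero zero w =
    trans (c-head-≡ b P w) (cong (c (b ∷ P) w +_) (sym (*-identityˡ (c P w))))
  c-expand P zero (suc j) w =
    trans (c-head-≢ (a ^ j ++ b ∷ P) w a≢b) (sym (+-identityʳ _))
  c-expand P (suc x) zero w =
    trans (c-head-≢ P (a ^ x ++ b ∷ w) b≢a)
          (trans (c-expand P x zero w) (cong (_+ _) (sym (c-head-≢ P (a ^ x ++ w) b≢a))))
  c-expand P (suc x) (suc j) w = begin
    c (a ∷ J) (a ∷ a ^ x ++ b ∷ w)
      ≡⟨ c-head-≡ a J (a ^ x ++ b ∷ w) ⟩
    c (a ∷ J) (a ^ x ++ b ∷ w) + c J (a ^ x ++ b ∷ w)
      ≡⟨ cong₂ _+_ (c-expand P x (suc j) w) (c-expand P x j w) ⟩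
    (c (a ∷ J) (a ^ x ++ w) + choose x (suc j) * c P w) + (c J (a ^ x ++ w) + choose x j * c P w)
      ≡⟨ +-CS.interchange (c (a ∷ J) (a ^ x ++ w)) (choose x (suc j) * c P w) (c J (a ^ x ++ w)) (choose x j * c P w) ⟩
    (c (a ∷ J) (a ^ x ++ w) + c J (a ^ x ++ w)) + (choose x (suc j) * c P w + choose x j * c P w)
      ≡⟨ cong₂ _+_ (sym (c-head-≡ a J (a ^ x ++ w))) (sym (*-distribʳ-+ (c P w) (choose x (suc j)) (choose x j))) ⟩
    c (a ∷ J) (a ∷ a ^ x ++ w) + choose (suc x) (suc j) * c P w ∎
    where
    open ≡-Reasoning
    J = a ^ j ++ b ∷ P

  module UpperBound (r q t : ℕ) where

    P : Word
    P = b ^ q ++ a ^ t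

    p : Word
    p = blocks a r (suc q) t

    SplitBound : ℕ → ℕ → Set
    SplitBound N m = ∀ β γ → β + γ ≡ N → choose β r * choose γ t ≤ m

    c-P-≤ : ∀ x u → choose x r * c P u ≤ choose x r * choose (A u) t * choose (B u) q
    c-P-≤ x u = ≤-trans (*-monoʳ-≤ (choose x r) (c-sorted-≤ q t u))
                        (≤-reflexive (*-CS.x∙yz≈xz∙y (choose x r) (choose (B u) q) (choose (A u) t)))

    module _ {N m : ℕ} (bound : SplitBound N m) where

      c-≤ : ∀ x w → x + A w ≡ N → c p (a ^ x ++ w) ≤ m * choose (B w) (suc q)
      c-≤ x [] _ rewrite ++-identityʳ (a ^ x) | c-no-b P x r = z≤n
      c-≤ x (y ∷ w) x+A≡N with letter y
      ... | inj₁ refl rewrite ^-++-∷ a x w | count-head-≢ w b≢a =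
        c-≤ (suc x) w (trans (sym (+-suc x (A w))) (trans (cong (x +_) (sym (count-head-≡ a w))) x+A≡N))
      ... | inj₂ refl = begin
        c p (a ^ x ++ b ∷ w)
          ≡⟨ c-expand P x r w ⟩
        c p (a ^ x ++ w) + choose x r * c P w
          ≤⟨ +-mono-≤ (c-≤ x w x+A≡N′) (≤-trans (c-P-≤ x w) (*-monoˡ-≤ _ (bound x (A w) x+A≡N′))) ⟩
        m * choose (B w) (suc q) + m * choose (B w) q
          ≡⟨ sym (*-distribˡ-+ m _ _) ⟩
        m * choose (suc (B w)) (suc q)
          ≡⟨ cong (λ n → m * choose n (suc q)) (sym (count-head-≡ b w)) ⟩
        m * choose (B (b ∷ w)) (suc q) ∎
        where
        open ≤-Reasoning
        x+A≡N′ : x + A w ≡ N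
        x+A≡N′ = trans (cong (x +_) (sym (count-head-≢ w a≢b))) x+A≡N

  module Strict (r q t : ℕ) where
    open UpperBound (suc r) (suc q) (suc t)

    c-P-<-product : ∀ x u → suc r ≤ x → suc t ≤ A u → suc q ≤ B u → numRuns (a ^ x ++ b ∷ u) ≢ 3 →
                    choose x (suc r) * c P u < choose x (suc r) * choose (A u) (suc t) * choose (B u) (suc q)
    c-P-<-product x u r<x t<A q<B ¬three with sortedView u
    ... | sorted j z = ⊥-elim (¬three (numRuns-blocks a (≤-trans (s≤s z≤n) r<x) (s≤s z≤n)
                                                         (≤-trans (s≤s z≤n) (subst (suc t ≤_) (A-sorted j z) t<A))))
    ... | unsorted uns = begin-strict
      choose x (suc r) * c P u
        <⟨ *-monoʳ-< _ {{>-nonZero (k≤n⇒0<choose r<x)}} (c-sorted-< q t u uns q<B t<A) ⟩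
      choose x (suc r) * (choose (B u) (suc q) * choose (A u) (suc t))
        ≡⟨ *-CS.x∙yz≈xz∙y (choose x (suc r)) (choose (B u) (suc q)) (choose (A u) (suc t)) ⟩
      choose x (suc r) * choose (A u) (suc t) * choose (B u) (suc q) ∎
      where open ≤-Reasoning

    module _ {N m : ℕ} (bound : SplitBound N m) where

      c-P-< : ∀ x u → x + A u ≡ N → 0 < m → suc q ≤ B u → numRuns (a ^ x ++ b ∷ u) ≢ 3 →
              choose x (suc r) * c P u < m * choose (B u) (suc q)
      c-P-< x u x+A≡N 0<m q<B ¬three with choose x (suc r) * choose (A u) (suc t) <? m
      ... | yes <m = ≤-<-trans (c-P-≤ x u) (*-monoˡ-< _ {{>-nonZero (k≤n⇒0<choose q<B)}} <m)
      ... | no  ≮m = <-≤-trans (c-P-<-product x u r<x t<A q<B ¬three) (*-monoˡ-≤ _ (bound x (A u) x+A≡N))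
        where
        0<CC : 0 < choose x (suc r) * choose (A u) (suc t)
        0<CC = <-≤-trans 0<m (≮⇒≥ ≮m)
        r<x = 0<choose⇒k≤n (0<*⇒0<ˡ (choose x (suc r)) 0<CC)
        t<A = 0<choose⇒k≤n (0<*⇒0<ʳ (choose x (suc r)) 0<CC)

      c-< : ∀ w → A w ≡ N → 0 < c p w → numRuns w ≢ 3 → c p w < m * choose (B w) (suc (suc q))
      c-< w A≡N 0<c ¬three with leadingAs w | ≤-trans 0<c (c-≤ bound 0 w A≡N)
      ... | only-a x  | _ = ⊥-elim (<-irrefl (sym (c-no-b P x (suc r))) 0<c)
      ... | a^-b∷ x u | 0<mC = begin-strict
        c p (a ^ x ++ b ∷ u)
          ≡⟨ c-expand P x (suc r) u ⟩
        c p (a ^ x ++ u) + choose x (suc r) * c P u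
          <⟨ +-mono-≤-< (c-≤ bound x u x+A≡N) (c-P-< x u x+A≡N 0<m q<B ¬three) ⟩
        m * choose (B u) (suc (suc q)) + m * choose (B u) (suc q)
          ≡⟨ sym (*-distribˡ-+ m _ _) ⟩
        m * choose (suc (B u)) (suc (suc q))
          ≡⟨ cong (λ n → m * choose n (suc (suc q))) (sym (B-a^-b∷ x u)) ⟩
        m * choose (B (a ^ x ++ b ∷ u)) (suc (suc q)) ∎
        where
        open ≤-Reasoning
        x+A≡N : x + A u ≡ N
        x+A≡N = trans (sym (A-a^-b∷ x u)) A≡N
        0<m = 0<*⇒0<ˡ m 0<mC
        q<B = ≤-pred (subst (suc (suc q) ≤_) (B-a^-b∷ x u) (0<choose⇒k≤n (0<*⇒0<ʳ m 0<mC)))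

    not-three-runs⇒c<M : ∀ w → 0 < c p w → numRuns w ≢ 3 → c p w < M (length w) p
    not-three-runs⇒c<M w 0<c ¬three with split-argmax (λ β γ → choose β (suc r) * choose γ (suc t)) (A w)
    ... | α , γ , α+γ≡A , max = begin-strict
      c p w
        <⟨ c-< max w refl 0<c ¬three ⟩
      choose α (suc r) * choose γ (suc t) * choose (B w) (suc (suc q))
        ≡⟨ *-CS.xy∙z≈xz∙y (choose α (suc r)) (choose γ (suc t)) (choose (B w) (suc (suc q))) ⟩
      choose α (suc r) * choose (B w) (suc (suc q)) * choose γ (suc t)
        ≤⟨ c-blocks-≥ a (suc r) (suc (suc q)) (suc t) α (B w) γ ⟩
      c p (blocks a α (B w) γ)
        ≤⟨ c≤M p (blocks a α (B w) γ) (length-blocks {w} α γ α+γ≡A) ⟩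
      M (length w) p ∎
      where open ≤-Reasoning

    maximal⇒three-runs : ∀ w → length p ≤ length w → c p w ≡ M (length w) p → numRuns w ≡ 3
    maximal⇒three-runs w p≤w c≡M =
      decidable-stable (numRuns w ≟ 3) (λ ¬three → <-irrefl c≡M (not-three-runs⇒c<M w 0<c ¬three))
      where
      padded-length : length (p ++ a ^ (length w ∸ length p)) ≡ length w
      padded-length = trans (length-++ p) (trans (cong (length p +_) (length-replicate _)) (m+[n∸m]≡n p≤w))
      0<c : 0 < c p w
      0<c = ≤-trans (c-self p (a ^ (length w ∸ length p)))
                    (≤-trans (c≤M p _ padded-length) (≤-reflexive (sym c≡M)))

mainTheorem17 : (p : Word) → (r₁ r₂ r₃ : ℕ) → runs p ≡ r₁ ∷ r₂ ∷ r₃ ∷ [] → r₂ ≥ 2 →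
    (n : ℕ) → length p ≤ n → (w : Word) → length w ≡ n → c p w ≡ M n p →
    numRuns w ≡ 3
mainTheorem17 p _ _ _ runs≡ 2≤r₂ _ p≤n w refl c≡M with three-runs-shape p runs≡ 2≤r₂
... | a , r , q , t , refl = Letters.Strict.maximal⇒three-runs a r q t w p≤n c≡M
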